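{- Let $q$ be a power of $2$ and let $c\in\mathbb{F}_{q^6}$. Define the polynomials in $\mathbb{F}_q[X]$ $$F_1(X)=X^{q^4+2q^3+q^2+q+1}+X^{q^4+q^3+q^2+1}+X^{q^3+q+1}+X+X^{2q^3+q^2+q}+X^{q^3+q^2+q}+X^{q^3}+1,$$ $$F_2(X)=X^{q^3+q^2+2q+2}+X^{q^2+q+2}+X^{q^3+2q^2+2q+1}+X^{2q^3+2q^2+q+1}+X^{q^2+q+1}+X^{q^3+q+1}+X^{q^3+q^2+1}+X+X^{2q^3+q^2+q}+X^{q^3+q^2+q}+X^{q^3}+1,$$ $$F_3(X)=X^{q^2+q+1}+1.$$ If $F_1(c)=F_2(c)=0$ and $F_3(c)\neq 0$, then $c\notin\mathbb{F}_{q^3}$. -}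

module Defs where

open import Level using (Level; _⊔_)
open import Data.Nat as Nat using (ℕ; suc)
open import Data.Fin using (Fin)
open import Data.Product using (Σ; ∃; _×_)
open import Relation.Nullary using (¬_)
open import Relation.Binary.PropositionalEquality as ≡ using (_≡_)
open import Function.Bundles using (Inverse)
open import Algebra.Bundles using (CommutativeRing; Semiring)
import Algebra.Definitions.RawSemiring as RS

IsField : ∀ {a ℓ} → CommutativeRing a ℓ → Set (a ⊔ ℓ)
IsField K = ¬ (1# ≈ 0#) × (∀ x → ¬ (x ≈ 0#) → ∃ λ y → (x * y) ≈ 1#)
  where open CommutativeRing K

HasCard : ∀ {a ℓ} → CommutativeRing a ℓ → ℕ → Set (a ⊔ ℓ)
HasCard K n = Inverse (≡.setoid (Fin n)) (CommutativeRing.setoid K)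

pow : ∀ {a ℓ} (K : CommutativeRing a ℓ) → CommutativeRing.Carrier K → ℕ → CommutativeRing.Carrier K
pow K = RS._^_ (Semiring.rawSemiring (CommutativeRing.semiring K))

-- Membership in the subfield F_{q^m} of a finite field containing it:
-- x lies in F_{Q} (Q = q^m) iff x^Q = x.
InSubfield : ∀ {a ℓ} (K : CommutativeRing a ℓ) → ℕ → CommutativeRing.Carrier K → Set ℓ
InSubfield K Q x = pow K x Q ≈ x
  where open CommutativeRing K

module Polys {a ℓ} (K : CommutativeRing a ℓ) (q : ℕ) where
  open CommutativeRing K
  open Nat using () renaming (_+_ to _⊕_; _*_ to _⊗_; _^_ to _↑_)

  infixr 8 _^_
  _^_ : Carrier → ℕ → Carrier
  _^_ = pow K

  F₁ : Carrier → Carrier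
  F₁ X = X ^ (q ↑ 4 ⊕ 2 ⊗ q ↑ 3 ⊕ q ↑ 2 ⊕ q ⊕ 1)
       + X ^ (q ↑ 4 ⊕ q ↑ 3 ⊕ q ↑ 2 ⊕ 1)
       + X ^ (q ↑ 3 ⊕ q ⊕ 1)
       + X
       + X ^ (2 ⊗ q ↑ 3 ⊕ q ↑ 2 ⊕ q)
       + X ^ (q ↑ 3 ⊕ q ↑ 2 ⊕ q)
       + X ^ (q ↑ 3)
       + 1#

  F₂ : Carrier → Carrier
  F₂ X = X ^ (q ↑ 3 ⊕ q ↑ 2 ⊕ 2 ⊗ q ⊕ 2)
       + X ^ (q ↑ 2 ⊕ q ⊕ 2)
       + X ^ (q ↑ 3 ⊕ 2 ⊗ q ↑ 2 ⊕ 2 ⊗ q ⊕ 1)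
       + X ^ (2 ⊗ q ↑ 3 ⊕ 2 ⊗ q ↑ 2 ⊕ q ⊕ 1)
       + X ^ (q ↑ 2 ⊕ q ⊕ 1)
       + X ^ (q ↑ 3 ⊕ q ⊕ 1)
       + X ^ (q ↑ 3 ⊕ q ↑ 2 ⊕ 1)
       + X
       + X ^ (2 ⊗ q ↑ 3 ⊕ q ↑ 2 ⊕ q)
       + X ^ (q ↑ 3 ⊕ q ↑ 2 ⊕ q)
       + X ^ (q ↑ 3)
       + 1#

  F₃ : Carrier → Carrier
  F₃ X = X ^ (q ↑ 2 ⊕ q ⊕ 1) + 1#

-- Characteristic 2 comes from counting: translation by a permutes a finite
-- abelian group, so summing all its elements gives |G| · a = 0; with
-- |K| = 2 ^ 6(k+1) this makes a power of 1 + 1 vanish, hence 1 + 1 = 0.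
--
-- If c lies in F_{q³}, its conjugates x = c, y = c^q, z = c^{q²} cycle with
-- period 3, and in characteristic 2 the polynomials become
-- F₃(c) = xyz + 1 and F₁(c) = (xyz + 1)(x²y + 1). As F₃(c) ≠ 0, the root of
-- F₁ forces x²y = 1, and raising to the q-th power also y²z = 1 and z²x = 1.
-- Substituting these three relations into F₂(c) collapses it to xyz + 1, so
-- F₂(c) = F₃(c) ≠ 0.
module Submission where

open import Defs
open import Level using (Level)
open import Data.Nat using (ℕ; zero; suc) renaming (_+_ to _⊕_; _*_ to _⊗_; _^_ to _↑_)
import Data.Nat.Properties as ℕ
open import Data.Fin using (Fin)
open import Data.Fin.Permutation using (Permutation; permutation)
open import Data.Product using (∃; _,_; proj₁; proj₂)
open import Relation.Nullary using (¬_)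
open import Relation.Binary.PropositionalEquality as ≡ using (_≡_)
open import Function.Bundles using (Inverse)
open import Algebra.Bundles using (AbelianGroup; CommutativeRing)
import Algebra.Definitions.RawMonoid as RawMonoid
import Algebra.Properties.CommutativeMonoid.Sum as Sum
import Algebra.Properties.Group as GroupProperties
import Algebra.Properties.Semiring.Mult as SemiringMult
import Algebra.Properties.CommutativeSemiring.Exp as Exp
import Algebra.Solver.Ring.NaturalCoefficients.Default as Solver
import Relation.Binary.Reasoning.Setoid as SetoidReasoning

module _ {c ℓ} (G : AbelianGroup c ℓ) where
  open AbelianGroup G
  open RawMonoid rawMonoid using (_×_)
  open Sum commutativeMonoid using (sum; sum-permute; sum-cong-≋; ∑-distrib-+; sum-replicate)
  open GroupProperties group using (identityʳ-unique)
  open SetoidReasoning setoid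

  card×≈ε : ∀ {m} → Inverse (≡.setoid (Fin m)) setoid → ∀ a → m × a ≈ ε
  card×≈ε {m} iv a = identityʳ-unique (sum to) (m × a) (sym (begin
    sum to                                   ≈⟨ sum-permute to translation ⟩
    sum {m} (λ i → to (from (to i ∙ a)))     ≈⟨ sum-cong-≋ {m} (λ i → strictlyInverseˡ (to i ∙ a)) ⟩
    sum {m} (λ i → to i ∙ a)                 ≈⟨ ∑-distrib-+ {m} to (λ _ → a) ⟩
    sum to ∙ sum {m} (λ _ → a)               ≈⟨ ∙-congˡ (sum-replicate m) ⟩
    sum to ∙ m × a                           ∎))
    where
    open Inverse iv using (to; from; from-cong; strictlyInverseˡ; strictlyInverseʳ)

    untranslate : ∀ b b′ → b ∙ b′ ≈ ε → ∀ i → from (to (from (to i ∙ b)) ∙ b′) ≡ i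
    untranslate b b′ b∙b′≈ε i = ≡.trans (from-cong (begin
      to (from (to i ∙ b)) ∙ b′  ≈⟨ ∙-congʳ (strictlyInverseˡ (to i ∙ b)) ⟩
      to i ∙ b ∙ b′              ≈⟨ assoc (to i) b b′ ⟩
      to i ∙ (b ∙ b′)            ≈⟨ ∙-congˡ b∙b′≈ε ⟩
      to i ∙ ε                   ≈⟨ identityʳ (to i) ⟩
      to i                       ∎)) (strictlyInverseʳ i)

    translation : Permutation m m
    translation = permutation (λ i → from (to i ∙ a)) (λ i → from (to i ∙ a ⁻¹))
      (untranslate (a ⁻¹) a (inverseˡ a)) (untranslate a (a ⁻¹) (inverseʳ a))

module _ {a ℓ} (K : CommutativeRing a ℓ) where
  open CommutativeRing K
  open SemiringMult semiring using (_×_; ×-homo-1; ×1-homo-*)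
  open Exp commutativeSemiring using (_^_; ^-congˡ; ^-congʳ; ^-homo-*; ^-assocʳ; ^-distrib-*)
  open Solver commutativeSemiring using (solve; _:+_; _:*_; _:=_; con)
  open SetoidReasoning setoid

  1#^n≈1# : ∀ n → 1# ^ n ≈ 1#
  1#^n≈1# zero    = refl
  1#^n≈1# (suc n) = trans (*-identityˡ _) (1#^n≈1# n)

  2^n×1#≈[1#+1#]^n : ∀ n → (2 ↑ n) × 1# ≈ (1# + 1#) ^ n
  2^n×1#≈[1#+1#]^n zero    = ×-homo-1 1#
  2^n×1#≈[1#+1#]^n (suc n) = trans (×1-homo-* 2 (2 ↑ n))
    (*-cong (+-congˡ (+-identityʳ 1#)) (2^n×1#≈[1#+1#]^n n))

  unit-cancelˡ : ∀ {u u⁻¹ v} → u * u⁻¹ ≈ 1# → u * v ≈ 0# → v ≈ 0#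
  unit-cancelˡ {u} {u⁻¹} {v} u*u⁻¹≈1 u*v≈0 = begin
    v               ≈⟨ *-identityˡ v ⟨
    1# * v          ≈⟨ *-congʳ u*u⁻¹≈1 ⟨
    u * u⁻¹ * v     ≈⟨ *-congʳ (*-comm u u⁻¹) ⟩
    u⁻¹ * u * v     ≈⟨ *-assoc u⁻¹ u v ⟩
    u⁻¹ * (u * v)   ≈⟨ *-congˡ u*v≈0 ⟩
    u⁻¹ * 0#        ≈⟨ zeroʳ u⁻¹ ⟩
    0#              ∎

  module _ (fld : IsField K) where

    ^-nonzero : ∀ {x} n → ¬ x ≈ 0# → ¬ x ^ n ≈ 0#
    ^-nonzero {x} n x≉0 x^n≈0 with proj₂ fld x x≉0
    ... | x⁻¹ , x*x⁻¹≈1 = proj₁ fld (begin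
      1#                ≈⟨ 1#^n≈1# n ⟨
      1# ^ n            ≈⟨ ^-congˡ n x*x⁻¹≈1 ⟨
      (x * x⁻¹) ^ n     ≈⟨ ^-distrib-* x x⁻¹ n ⟩
      x ^ n * x⁻¹ ^ n   ≈⟨ *-congʳ x^n≈0 ⟩
      0# * x⁻¹ ^ n      ≈⟨ zeroˡ _ ⟩
      0#                ∎)

    characteristic-two : ∀ {n} → HasCard K (2 ↑ n) → ¬ ¬ (1# + 1# ≈ 0#)
    characteristic-two {n} card 2≉0 = ^-nonzero n 2≉0
      (trans (sym (2^n×1#≈[1#+1#]^n n)) (card×≈ε +-abelianGroup card 1#))

  module _ (1#+1#≈0# : 1# + 1# ≈ 0#) where

    drop-2* : ∀ u w → u + (1# + 1#) * w ≈ u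
    drop-2* u w = begin
      u + (1# + 1#) * w  ≈⟨ +-congˡ (*-congʳ 1#+1#≈0#) ⟩
      u + 0# * w         ≈⟨ +-congˡ (zeroˡ w) ⟩
      u + 0#             ≈⟨ +-identityʳ u ⟩
      u                  ∎

    +1#≈0#⇒≈1# : ∀ {w} → w + 1# ≈ 0# → w ≈ 1#
    +1#≈0#⇒≈1# {w} w+1≈0 = begin
      w                  ≈⟨ drop-2* w 1# ⟨
      w + (1# + 1#) * 1# ≈⟨ solve 1 (λ w → w :+ (con 1 :+ con 1) :* con 1 := (w :+ con 1) :+ con 1) refl w ⟩
      (w + 1#) + 1#      ≈⟨ +-congʳ w+1≈0 ⟩
      0# + 1#            ≈⟨ +-identityˡ 1# ⟩
      1#                 ∎

    -- These identities hold only in characteristic 2; the solver proves them in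
    -- every commutative ring with the even part (1# + 1#) * _ made explicit.
    F₁-factorisation : ∀ x y z →
      y * (x * x) * z * y * x + y * x * z * x + x * y * x + x + x * x * z * y + x * z * y + x + 1#
        ≈ (z * y * x + 1#) * (x * x * y + 1#)
    F₁-factorisation x y z = trans
      (solve 3 (λ x y z →
          y :* (x :* x) :* z :* y :* x :+ y :* x :* z :* x :+ x :* y :* x :+ x :+ x :* x :* z :* y :+ x :* z :* y :+ x :+ con 1
        := (z :* y :* x :+ con 1) :* (x :* x :* y :+ con 1) :+ (con 1 :+ con 1) :* (x :* x :* y :* z :+ x)) refl x y z)
      (drop-2* _ _)

    F₂-regrouping : ∀ x y z →
      x * z * (y * y) * (x * x) + z * y * (x * x) + x * (z * z) * (y * y) * x + x * x * (z * z) * y * x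
        + z * y * x + x * y * x + x * z * x + x + x * x * z * y + x * z * y + x + 1#
        ≈ x * x * y * (z * y * x) + x * x * z * (y * y * z) + x * x * y * (z * z * x) + x * x * y + x * x * z + 1#
    F₂-regrouping x y z = trans
      (solve 3 (λ x y z →
          x :* z :* (y :* y) :* (x :* x) :+ z :* y :* (x :* x) :+ x :* (z :* z) :* (y :* y) :* x :+ x :* x :* (z :* z) :* y :* x
          :+ z :* y :* x :+ x :* y :* x :+ x :* z :* x :+ x :+ x :* x :* z :* y :+ x :* z :* y :+ x :+ con 1
        := x :* x :* y :* (z :* y :* x) :+ x :* x :* z :* (y :* y :* z) :+ x :* x :* y :* (z :* z :* x) :+ x :* x :* y :+ x :* x :* z :+ con 1
          :+ (con 1 :+ con 1) :* (x :* x :* y :* z :+ x :* y :* z :+ x)) refl x y z)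
      (drop-2* _ _)

    module Conjugates (q : ℕ) (x : Carrier) (x^q³≈x : x ^ (q ↑ 3) ≈ x) where
      open Polys K q using (F₁; F₂; F₃)

      y z : Carrier
      y = x ^ q
      z = y ^ q

      x^q^[1+n] : ∀ n → x ^ (q ↑ suc n) ≈ (x ^ (q ↑ n)) ^ q
      x^q^[1+n] n = trans (^-congʳ x (ℕ.*-comm q (q ↑ n))) (sym (^-assocʳ x (q ↑ n) q))

      -- x ^ m ≈ u as a record: unlike the reducing term x ^ m, its index m can
      -- be inferred, so monomials can be assembled with _⊞_ without annotations.
      record Pow (m : ℕ) (u : Carrier) : Set ℓ where
        constructor pow≈
        field ⌊_⌋ : x ^ m ≈ u
      open Pow

      x^1 : Pow 1 x
      x^1 = pow≈ (*-identityʳ x)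

      x^q : Pow q y
      x^q = pow≈ refl

      x^q² : Pow (q ↑ 2) z
      x^q² = pow≈ (trans (x^q^[1+n] 1) (^-congˡ q (trans (x^q^[1+n] 0) (^-congˡ q ⌊ x^1 ⌋))))

      x^q³ : Pow (q ↑ 3) x
      x^q³ = pow≈ x^q³≈x

      x^q⁴ : Pow (q ↑ 4) y
      x^q⁴ = pow≈ (trans (x^q^[1+n] 3) (^-congˡ q x^q³≈x))

      z^q : z ^ q ≈ x
      z^q = trans (^-congˡ q (sym ⌊ x^q² ⌋)) (trans (sym (x^q^[1+n] 2)) x^q³≈x)

      infixl 7 _⊞_
      infixl 6 _⟨+⟩_

      _⊞_ : ∀ {m n u v} → Pow m u → Pow n v → Pow (m ⊕ n) (u * v)
      _⊞_ {m} {n} p r = pow≈ (trans (^-homo-* x m n) (*-cong ⌊ p ⌋ ⌊ r ⌋))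

      twice : ∀ {m u} → Pow m u → Pow (2 ⊗ m) (u * u)
      twice {m} p = pow≈ (trans (^-congʳ x (≡.cong (m ⊕_) (ℕ.+-identityʳ m))) ⌊ p ⊞ p ⌋)

      _⟨+⟩_ : ∀ {u u′ v v′} → u ≈ u′ → v ≈ v′ → u + v ≈ u′ + v′
      _⟨+⟩_ = +-cong

      F₁-expansion : F₁ x ≈ y * (x * x) * z * y * x + y * x * z * x + x * y * x + x + x * x * z * y + x * z * y + x + 1#
      F₁-expansion = ⌊ x^q⁴ ⊞ twice x^q³ ⊞ x^q² ⊞ x^q ⊞ x^1 ⌋ ⟨+⟩ ⌊ x^q⁴ ⊞ x^q³ ⊞ x^q² ⊞ x^1 ⌋ ⟨+⟩ ⌊ x^q³ ⊞ x^q ⊞ x^1 ⌋ ⟨+⟩ refl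
        ⟨+⟩ ⌊ twice x^q³ ⊞ x^q² ⊞ x^q ⌋ ⟨+⟩ ⌊ x^q³ ⊞ x^q² ⊞ x^q ⌋ ⟨+⟩ ⌊ x^q³ ⌋ ⟨+⟩ refl

      F₂-expansion : F₂ x ≈ x * z * (y * y) * (x * x) + z * y * (x * x) + x * (z * z) * (y * y) * x + x * x * (z * z) * y * x
                              + z * y * x + x * y * x + x * z * x + x + x * x * z * y + x * z * y + x + 1#
      F₂-expansion = ⌊ x^q³ ⊞ x^q² ⊞ twice x^q ⊞ twice x^1 ⌋ ⟨+⟩ ⌊ x^q² ⊞ x^q ⊞ twice x^1 ⌋
        ⟨+⟩ ⌊ x^q³ ⊞ twice x^q² ⊞ twice x^q ⊞ x^1 ⌋ ⟨+⟩ ⌊ twice x^q³ ⊞ twice x^q² ⊞ x^q ⊞ x^1 ⌋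
        ⟨+⟩ ⌊ x^q² ⊞ x^q ⊞ x^1 ⌋ ⟨+⟩ ⌊ x^q³ ⊞ x^q ⊞ x^1 ⌋ ⟨+⟩ ⌊ x^q³ ⊞ x^q² ⊞ x^1 ⌋ ⟨+⟩ refl
        ⟨+⟩ ⌊ twice x^q³ ⊞ x^q² ⊞ x^q ⌋ ⟨+⟩ ⌊ x^q³ ⊞ x^q² ⊞ x^q ⌋ ⟨+⟩ ⌊ x^q³ ⌋ ⟨+⟩ refl

      F₃-expansion : F₃ x ≈ z * y * x + 1#
      F₃-expansion = ⌊ x^q² ⊞ x^q ⊞ x^1 ⌋ ⟨+⟩ refl

      ^q-distrib-u*u*v : ∀ u v → (u * u * v) ^ q ≈ u ^ q * u ^ q * v ^ q
      ^q-distrib-u*u*v u v = trans (^-distrib-* (u * u) v q) (*-congʳ (^-distrib-* u u q))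

      module _ (F₃-unit : ∃ λ w → F₃ x * w ≈ 1#) (F₁≈0 : F₁ x ≈ 0#) where

        x*x*y≈1 : x * x * y ≈ 1#
        x*x*y≈1 = +1#≈0#⇒≈1# (unit-cancelˡ N+1-unit (begin
          (z * y * x + 1#) * (x * x * y + 1#)  ≈⟨ F₁-factorisation x y z ⟨
          _                                    ≈⟨ F₁-expansion ⟨
          F₁ x                                 ≈⟨ F₁≈0 ⟩
          0#                                   ∎))
          where
          N+1-unit : (z * y * x + 1#) * proj₁ F₃-unit ≈ 1#
          N+1-unit = trans (*-congʳ (sym F₃-expansion)) (proj₂ F₃-unit)

        y*y*z≈1 : y * y * z ≈ 1#
        y*y*z≈1 = trans (sym (^q-distrib-u*u*v x y)) (trans (^-congˡ q x*x*y≈1) (1#^n≈1# q))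

        z*z*x≈1 : z * z * x ≈ 1#
        z*z*x≈1 = trans (*-congˡ (sym z^q))
          (trans (sym (^q-distrib-u*u*v y z)) (trans (^-congˡ q y*y*z≈1) (1#^n≈1# q)))

        F₂≈F₃ : F₂ x ≈ F₃ x
        F₂≈F₃ = begin
          F₂ x                                ≈⟨ trans F₂-expansion (F₂-regrouping x y z) ⟩
          x * x * y * (z * y * x) + x * x * z * (y * y * z) + x * x * y * (z * z * x) + x * x * y + x * x * z + 1#
            ≈⟨ *-congʳ x*x*y≈1 ⟨+⟩ *-congˡ y*y*z≈1 ⟨+⟩ *-cong x*x*y≈1 z*z*x≈1 ⟨+⟩ x*x*y≈1 ⟨+⟩ refl ⟨+⟩ refl ⟩
          1# * (z * y * x) + x * x * z * 1# + 1# * 1# + 1# + x * x * z + 1#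
            ≈⟨ trans (solve 2 (λ n u → con 1 :* n :+ u :* con 1 :+ con 1 :* con 1 :+ con 1 :+ u :+ con 1
                                 := n :+ con 1 :+ (con 1 :+ con 1) :* (u :+ con 1)) refl (z * y * x) (x * x * z))
                     (drop-2* _ _) ⟩
          z * y * x + 1#                      ≈⟨ F₃-expansion ⟨
          F₃ x                                ∎

open import Data.Nat using (_^_)

lemma2p2 : {a ℓ : Level} (k : ℕ) (K : CommutativeRing a ℓ) → IsField K
    → HasCard K ((2 ^ suc k) ^ 6)
    → (c : CommutativeRing.Carrier K)
    → CommutativeRing._≈_ K (Polys.F₁ K (2 ^ suc k) c) (CommutativeRing.0# K)
    → CommutativeRing._≈_ K (Polys.F₂ K (2 ^ suc k) c) (CommutativeRing.0# K)
    → ¬ CommutativeRing._≈_ K (Polys.F₃ K (2 ^ suc k) c) (CommutativeRing.0# K)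
    → ¬ InSubfield K ((2 ^ suc k) ^ 3) c
lemma2p2 k K fld card c F₁≈0 F₂≈0 F₃≉0 c∈F =
  characteristic-two K fld {suc k ⊗ 6} (≡.subst (HasCard K) (ℕ.^-*-assoc 2 (suc k) 6) card) λ 1+1≈0 →
    F₃≉0 (trans (sym (Conjugates.F₂≈F₃ K 1+1≈0 q c c∈F (proj₂ fld _ F₃≉0) F₁≈0)) F₂≈0)
  where
  open CommutativeRing K using (trans; sym)
  q = 2 ^ suc k
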